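{- Let $s,t\ge 3$ be integers. (i) If $d\in\{1,\dots,t-1\}$ and $\varphi$ is the cyclic $d$-shift of $C_t$, then $C_s\Box^{\varphi}C_t$ is bipartite if and only if $t$ is even and $s$ and $d$ have the same parity. (ii) If $\varphi$ is a reflection of $C_t$, then $C_s\Box^{\varphi}C_t$ is bipartite if and only if either $\varphi$ has no fixed points and $s$ is odd, or $\varphi$ has two fixed points and $s$ is even.
   Context: The cycle $C_t$ has vertex set $\{1,\dots,t\}$ with $j$ adjacent to $j\pm 1$ (mod $t$). The cyclic $d$-shift of $C_t$ is the automorphism $j\mapsto j+d\pmod t$. A reflection of $C_t$ is an automorphism of the form $j\mapsto c-j\pmod t$ for some integer $c$; it has one fixed point if $t$ is odd and either zero or two fixed points if $t$ is even. For an automorphism $\varphi$ of $C_t$, the Cartesian graph bundle $C_s\Box^{\varphi}C_t$ is the graph with vertex set $\{(i,j):1\le i\le s,\ 1\le j\le t\}$ and edges: $(i,j)\sim(i,j+1)$ (second coordinate mod $t$) for all $i,j$; $(i,j)\sim(i+1,j)$ for $1\le i\le s-1$ and all $j$; and $(s,j)\sim(1,\varphi(j))$ for all $j$. -}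

module Defs where

open import Data.Nat using (ℕ; zero; suc; _+_; _∸_; _<_; NonZero)
open import Data.Nat.DivMod using (_%_)
open import Data.Nat.Properties using (_≟_)
open import Data.Integer as ℤ using (ℤ; +_)
open import Data.Integer.DivMod using (_%ℕ_)
open import Data.Product using (_×_; _,_; ∃)
open import Data.Bool using (Bool)
open import Data.List using (length; filter; upTo)
open import Relation.Binary.PropositionalEquality using (_≡_; _≢_)

-- Conventions: vertices of C_t are labelled 0,…,t-1 (instead of 1,…,t);
-- the layer index of C_s is likewise 0,…,s-1.  This is a relabelling only.

shift : (t : ℕ) .{{_ : NonZero t}} → ℕ → ℕ → ℕ
shift t d j = (j + d) % t

reflection : (t : ℕ) .{{_ : NonZero t}} → ℤ → ℕ → ℕ
reflection t c j = (c ℤ.- + j) %ℕ t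

fixCount : (t : ℕ) → (ℕ → ℕ) → ℕ
fixCount t φ = length (filter (λ j → φ j ≟ j) (upTo t))

data BundleEdge (s t : ℕ) .{{_ : NonZero t}} (φ : ℕ → ℕ) : ℕ × ℕ → ℕ × ℕ → Set where
  fibre : ∀ {i j} → i < s → j < t → BundleEdge s t φ (i , j) (i , suc j % t)
  base  : ∀ {i j} → suc i < s → j < t → BundleEdge s t φ (i , j) (suc i , j)
  twist : ∀ {j} → j < t → BundleEdge s t φ (s ∸ 1 , j) (0 , φ j)

Bipartite : (s t : ℕ) .{{_ : NonZero t}} → (ℕ → ℕ) → Set
Bipartite s t φ =
  ∃ λ (col : ℕ × ℕ → Bool) → ∀ {u v} → BundleEdge s t φ u v → col u ≢ col v

-- Colour (i , j) by the parity of i + j.  Walking once around the fibre over 0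
-- and then along the base shows that every proper 2-colouring forces t to be even and
-- φ 0 ≡ s (mod 2).  Conversely, if t is even and φ j ≡ φ 0 + j (mod 2), as holds for shifts
-- and reflections, the parity colouring is proper.  For a reflection the fixed points are
-- the j < t with 2j ∈ {r, r + t}, r = c mod t, so there are 2, 0 or 1 of them according as
-- r and t are both even, r is odd and t even, or t is odd.

module Submission where

open import Defs
open import Data.Nat using (ℕ; _≤_; _<_; NonZero)
open import Data.Nat.DivMod using (_%_)
open import Data.Integer using (ℤ)
open import Data.Product using (_×_)
open import Data.Sum using (_⊎_)
open import Function.Bundles using (_⇔_)
open import Relation.Binary.PropositionalEquality using (_≡_)

open import Data.Nat using (zero; suc; _+_; _*_; z≤n; s≤s; parity; ⌊_/2⌋; >-nonZero⁻¹)
import Data.Nat.Properties as ℕP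
open import Data.Nat.DivMod using (_/_; m≡m%n+[m/n]*n; m<n⇒m%n≡m; n%n≡0; [m+n]%n≡m%n)
open import Data.Integer as ℤ using (-[1+_])
import Data.Integer.Properties as ℤP
open import Data.Integer.DivMod using (_%ℕ_; _/ℕ_; n%ℕd<d; a≡a%ℕn+[a/ℕn]*n)
open import Data.Integer.Tactic.RingSolver using (solve-∀)
open import Data.Parity.Base as ℙ using (Parity; 0ℙ; 1ℙ; _⁻¹)
import Data.Parity.Properties as ℙP
open import Data.Bool using (Bool; true; false)
open import Data.List using (upTo; filter; length; [_]; _++_)
import Data.List.Properties as List
open import Data.Product using (_,_)
open import Data.Product.Function.NonDependent.Propositional using (_×-⇔_)
open import Data.Sum using (inj₁; inj₂)
import Data.Sum as Sum
open import Function.Base using (_∘_)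
open import Function.Bundles using (Equivalence; mk⇔)
import Function.Properties.Equivalence as ⇔
open import Relation.Nullary using (¬_; Dec; yes; no; contradiction)
open import Relation.Unary using (Pred; Decidable)
open import Relation.Binary.PropositionalEquality
  using (_≢_; refl; sym; trans; cong; cong₂; subst; subst₂; module ≡-Reasoning)

open ≡-Reasoning

-- Parity

parity-suc : ∀ n → parity (suc n) ≡ parity n ⁻¹
parity-suc n = trans (sym (ℙP.⁻¹-involutive _)) (cong _⁻¹ (ℙP.suc-homo-⁻¹ n))

parity-double : ∀ n → parity (n + n) ≡ 0ℙ
parity-double n = trans (ℙP.+-homo-+ n n) (ℙP.p+p≡0ℙ (parity n))

⁻¹-distribʳ-+ : ∀ p q → (p ℙ.+ q) ⁻¹ ≡ p ℙ.+ q ⁻¹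
⁻¹-distribʳ-+ 0ℙ q = refl
⁻¹-distribʳ-+ 1ℙ q = refl

+≡⇒≡+ : ∀ {p q r} → p ℙ.+ q ≡ r → p ≡ r ℙ.+ q
+≡⇒≡+ {p} {q} {r} eq = begin
  p                 ≡⟨ sym (ℙP.+-identityʳ p) ⟩
  p ℙ.+ 0ℙ          ≡⟨ cong (p ℙ.+_) (sym (ℙP.p+p≡0ℙ q)) ⟩
  p ℙ.+ (q ℙ.+ q)   ≡⟨ sym (ℙP.+-assoc p q q) ⟩
  p ℙ.+ q ℙ.+ q     ≡⟨ cong (ℙ._+ q) eq ⟩
  r ℙ.+ q           ∎

parity-%-even : ∀ m t .{{_ : NonZero t}} → parity t ≡ 0ℙ → parity (m % t) ≡ parity m
parity-%-even m t t-even = sym (begin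
  parity m                                 ≡⟨ cong parity (m≡m%n+[m/n]*n m t) ⟩
  parity (m % t + m / t * t)               ≡⟨ ℙP.+-homo-+ (m % t) _ ⟩
  parity (m % t) ℙ.+ parity (m / t * t)    ≡⟨ cong (parity (m % t) ℙ.+_) multiple-even ⟩
  parity (m % t) ℙ.+ 0ℙ                    ≡⟨ ℙP.+-identityʳ _ ⟩
  parity (m % t)                           ∎)
  where
  multiple-even : parity (m / t * t) ≡ 0ℙ
  multiple-even = trans (ℙP.*-homo-* (m / t) t)
    (trans (cong (parity (m / t) ℙ.*_) t-even) (ℙP.*-zeroʳ _))

toℕ : Parity → ℕ
toℕ 0ℙ = 0
toℕ 1ℙ = 1

toℕ-injective : ∀ {p q} → toℕ p ≡ toℕ q → p ≡ q
toℕ-injective {0ℙ} {0ℙ} _ = refl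
toℕ-injective {1ℙ} {1ℙ} _ = refl

%2≡toℕ∘parity : ∀ m → m % 2 ≡ toℕ (parity m)
%2≡toℕ∘parity zero          = refl
%2≡toℕ∘parity (suc zero)    = refl
%2≡toℕ∘parity (suc (suc m)) =
  trans (cong (_% 2) (ℕP.+-comm 2 m)) (trans ([m+n]%n≡m%n m 2) (%2≡toℕ∘parity m))

parity≡⇔%2≡ : ∀ m n → (parity m ≡ parity n) ⇔ (m % 2 ≡ n % 2)
parity≡⇔%2≡ m n = mk⇔
  (λ eq → trans (%2≡toℕ∘parity m) (trans (cong toℕ eq) (sym (%2≡toℕ∘parity n))))
  (λ eq → toℕ-injective (trans (sym (%2≡toℕ∘parity m)) (trans eq (%2≡toℕ∘parity n))))

half-double : ∀ m → parity m ≡ 0ℙ → ⌊ m /2⌋ + ⌊ m /2⌋ ≡ m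
half-double zero          _      = refl
half-double (suc (suc m)) m-even =
  cong suc (trans (ℕP.+-suc ⌊ m /2⌋ ⌊ m /2⌋) (cong suc (half-double m m-even)))

double-injective : ∀ {m n} → m + m ≡ n + n → m ≡ n
double-injective {m} {n} eq = ℕP.*-cancelˡ-≡ m n 2 (begin
  m + (m + 0)  ≡⟨ cong (m +_) (ℕP.+-identityʳ m) ⟩
  m + m        ≡⟨ eq ⟩
  n + n        ≡⟨ cong (n +_) (sym (ℕP.+-identityʳ n)) ⟩
  n + (n + 0)  ∎)

-- Counting

count : ∀ {p} {P : Pred ℕ p} → Decidable P → ℕ → ℕ
count P? n = length (filter P? (upTo n))

module _ {p} {P : Pred ℕ p} (P? : Decidable P) where

  count-suc : ∀ n → count P? (suc n) ≡ count P? n + length (filter P? [ n ])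
  count-suc n = begin
    length (filter P? (upTo (suc n)))              ≡⟨ cong (length ∘ filter P?) (sym (List.upTo-∷ʳ n)) ⟩
    length (filter P? (upTo n ++ [ n ]))           ≡⟨ cong length (List.filter-++ P? (upTo n) [ n ]) ⟩
    length (filter P? (upTo n) ++ filter P? [ n ]) ≡⟨ List.length-++ (filter P? (upTo n)) ⟩
    count P? n + length (filter P? [ n ])          ∎

  count-suc-accept : ∀ {n} → P n → count P? (suc n) ≡ suc (count P? n)
  count-suc-accept {n} pn = begin
    count P? (suc n)                       ≡⟨ count-suc n ⟩
    count P? n + length (filter P? [ n ])  ≡⟨ cong (λ xs → count P? n + length xs) (List.filter-accept P? pn) ⟩
    count P? n + 1                         ≡⟨ ℕP.+-comm _ 1 ⟩
    suc (count P? n)                       ∎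

  count-suc-reject : ∀ {n} → ¬ P n → count P? (suc n) ≡ count P? n
  count-suc-reject {n} ¬pn = begin
    count P? (suc n)                       ≡⟨ count-suc n ⟩
    count P? n + length (filter P? [ n ])  ≡⟨ cong (λ xs → count P? n + length xs) (List.filter-reject P? ¬pn) ⟩
    count P? n + 0                         ≡⟨ ℕP.+-identityʳ _ ⟩
    count P? n                             ∎

  count-none : ∀ n → (∀ j → j < n → ¬ P j) → count P? n ≡ 0
  count-none zero    _    = refl
  count-none (suc n) none =
    trans (count-suc-reject (none n ℕP.≤-refl)) (count-none n (λ j j<n → none j (ℕP.m<n⇒m<1+n j<n)))

module _ {p q r} {P : Pred ℕ p} {Q : Pred ℕ q} {R : Pred ℕ r}
         (P? : Decidable P) (Q? : Decidable Q) (R? : Decidable R) where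

  count-⊎ : ∀ n → (∀ j → j < n → P j ⇔ (Q j ⊎ R j)) → (∀ j → ¬ (Q j × R j)) →
            count P? n ≡ count Q? n + count R? n
  count-⊎ zero    _     _        = refl
  count-⊎ (suc n) P⇔Q⊎R disjoint = step (Q? n) (R? n)
    where
    ih : count P? n ≡ count Q? n + count R? n
    ih = count-⊎ n (λ j j<n → P⇔Q⊎R j (ℕP.m<n⇒m<1+n j<n)) disjoint

    open Equivalence (P⇔Q⊎R n ℕP.≤-refl)

    step : Dec (Q n) → Dec (R n) → count P? (suc n) ≡ count Q? (suc n) + count R? (suc n)
    step (yes qn) (yes rn) = contradiction (qn , rn) (disjoint n)
    step (yes qn) (no ¬rn) = begin
      count P? (suc n)                     ≡⟨ count-suc-accept P? (from (inj₁ qn)) ⟩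
      suc (count P? n)                     ≡⟨ cong suc ih ⟩
      suc (count Q? n) + count R? n        ≡⟨ cong₂ _+_ (count-suc-accept Q? qn) (count-suc-reject R? ¬rn) ⟨
      count Q? (suc n) + count R? (suc n)  ∎
    step (no ¬qn) (yes rn) = begin
      count P? (suc n)                     ≡⟨ count-suc-accept P? (from (inj₂ rn)) ⟩
      suc (count P? n)                     ≡⟨ cong suc ih ⟩
      suc (count Q? n + count R? n)        ≡⟨ ℕP.+-suc (count Q? n) _ ⟨
      count Q? n + suc (count R? n)        ≡⟨ cong₂ _+_ (count-suc-reject Q? ¬qn) (count-suc-accept R? rn) ⟨
      count Q? (suc n) + count R? (suc n)  ∎
    step (no ¬qn) (no ¬rn) = begin
      count P? (suc n)                     ≡⟨ count-suc-reject P? (λ pn → Sum.[ ¬qn , ¬rn ] (to pn)) ⟩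
      count P? n                           ≡⟨ ih ⟩
      count Q? n + count R? n              ≡⟨ cong₂ _+_ (count-suc-reject Q? ¬qn) (count-suc-reject R? ¬rn) ⟨
      count Q? (suc n) + count R? (suc n)  ∎

count-≡ : ∀ {k n} → k < n → count (ℕP._≟ k) n ≡ 1
count-≡ {k} {suc n} k<1+n with ℕP.m<1+n⇒m<n∨m≡n k<1+n
... | inj₁ k<n  = trans (count-suc-reject (ℕP._≟ k) (ℕP.<⇒≢ k<n ∘ sym)) (count-≡ k<n)
... | inj₂ refl = trans (count-suc-accept (ℕP._≟ k) refl)
                        (cong suc (count-none (ℕP._≟ k) n (λ j j<n → ℕP.<⇒≢ j<n)))

count-double : ∀ {m n} → m < n + n → count (λ j → j + j ℕP.≟ m) n ≡ toℕ (parity m ⁻¹)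
count-double {m} {n} m<2n with parity m in m-parity
... | 1ℙ = count-none _ n (λ j _ j+j≡m → 0≢1 (trans (sym (parity-double j)) (trans (cong parity j+j≡m) m-parity)))
  where
  0≢1 : 0ℙ ≢ 1ℙ
  0≢1 ()
... | 0ℙ = begin
  count (λ j → j + j ℕP.≟ m) n  ≡⟨ cong length (List.filter-≐ _ _ (double≡m⇒≡h , ≡h⇒double≡m) (upTo n)) ⟩
  count (ℕP._≟ h) n             ≡⟨ count-≡ h<n ⟩
  1                             ∎
  where
  h = ⌊ m /2⌋
  h+h≡m : h + h ≡ m
  h+h≡m = half-double m m-parity
  double≡m⇒≡h : ∀ {j} → j + j ≡ m → j ≡ h
  double≡m⇒≡h j+j≡m = double-injective (trans j+j≡m (sym h+h≡m))
  ≡h⇒double≡m : ∀ {j} → j ≡ h → j + j ≡ m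
  ≡h⇒double≡m refl = h+h≡m
  h<n : h < n
  h<n = ℕP.≰⇒> (λ n≤h → ℕP.<⇒≱ (subst (_< n + n) (sym h+h≡m) m<2n) (ℕP.+-mono-≤ n≤h n≤h))

-- Two-colourings of the bundle

fromBool : Bool → Parity
fromBool false = 0ℙ
fromBool true  = 1ℙ

fromBool-≢ : ∀ {a b} → a ≢ b → fromBool b ≡ fromBool a ⁻¹
fromBool-≢ {false} {false} a≢b = contradiction refl a≢b
fromBool-≢ {false} {true}  _   = refl
fromBool-≢ {true}  {false} _   = refl
fromBool-≢ {true}  {true}  a≢b = contradiction refl a≢b

toBool : Parity → Bool
toBool 0ℙ = false
toBool 1ℙ = true

toBool-⁻¹ : ∀ p → toBool p ≢ toBool (p ⁻¹)
toBool-⁻¹ 0ℙ ()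
toBool-⁻¹ 1ℙ ()

parity-walk : ∀ {a} {V : Set a} (κ : V → Parity) (w : ℕ → V) {n} →
              (∀ k → k < n → κ (w (suc k)) ≡ κ (w k) ⁻¹) →
              ∀ k → k ≤ n → κ (w k) ≡ κ (w 0) ℙ.+ parity k
parity-walk κ w step zero    _   = sym (ℙP.+-identityʳ _)
parity-walk κ w step (suc k) k<n = begin
  κ (w (suc k))               ≡⟨ step k k<n ⟩
  κ (w k) ⁻¹                  ≡⟨ cong _⁻¹ (parity-walk κ w step k (ℕP.<⇒≤ k<n)) ⟩
  (κ (w 0) ℙ.+ parity k) ⁻¹   ≡⟨ ⁻¹-distribʳ-+ (κ (w 0)) (parity k) ⟩
  κ (w 0) ℙ.+ parity k ⁻¹     ≡⟨ cong (κ (w 0) ℙ.+_) (parity-suc k) ⟨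
  κ (w 0) ℙ.+ parity (suc k)  ∎

weight : ℕ × ℕ → ℕ
weight (i , j) = i + j

module _ (s t : ℕ) .{{_ : NonZero t}} (φ : ℕ → ℕ) where

  parity-colouring : parity t ≡ 0ℙ → (∀ j → j < t → parity (φ j) ≡ parity (suc s + j)) →
                     Bipartite (suc s) t φ
  parity-colouring t-even twist-parity = toBool ∘ parity ∘ weight , proper
    where
    flips : ∀ {u v} → BundleEdge (suc s) t φ u v → parity (weight v) ≡ parity (weight u) ⁻¹
    flips (fibre {i} {j} _ _) = begin
      parity (i + suc j % t)             ≡⟨ ℙP.+-homo-+ i (suc j % t) ⟩
      parity i ℙ.+ parity (suc j % t)    ≡⟨ cong (parity i ℙ.+_) (parity-%-even (suc j) t t-even) ⟩
      parity i ℙ.+ parity (suc j)        ≡⟨ ℙP.+-homo-+ i (suc j) ⟨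
      parity (i + suc j)                 ≡⟨ cong parity (ℕP.+-suc i j) ⟩
      parity (suc (i + j))               ≡⟨ parity-suc (i + j) ⟩
      parity (i + j) ⁻¹                  ∎
    flips (base {i} {j} _ _) = parity-suc (i + j)
    flips (twist {j} j<t)    = trans (twist-parity j j<t) (parity-suc (s + j))

    proper : ∀ {u v} → BundleEdge (suc s) t φ u v → toBool (parity (weight u)) ≢ toBool (parity (weight v))
    proper {u} e eq = toBool-⁻¹ (parity (weight u)) (trans eq (cong toBool (flips e)))

  bipartite⇒parity : φ 0 < t → Bipartite (suc s) t φ → parity t ≡ 0ℙ × parity (φ 0) ≡ parity (suc s)
  bipartite⇒parity φ0<t (colour , proper) = t-even , twist-parity
    where
    κ : ℕ × ℕ → Parity
    κ = fromBool ∘ colour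

    κ₀ = κ (0 , 0)

    flips : ∀ {u v} → BundleEdge (suc s) t φ u v → κ v ≡ κ u ⁻¹
    flips e = fromBool-≢ (proper e)

    0<t : 0 < t
    0<t = >-nonZero⁻¹ t

    around-fibre : ∀ j → j ≤ t → κ (0 , j % t) ≡ κ₀ ℙ.+ parity j
    around-fibre j j≤t = trans (parity-walk κ (λ j → 0 , j % t) step j j≤t)
                               (cong (λ x → κ (0 , x) ℙ.+ parity j) (m<n⇒m%n≡m 0<t))
      where
      step : ∀ j → j < t → κ (0 , suc j % t) ≡ κ (0 , j % t) ⁻¹
      step j j<t = subst (λ x → κ (0 , suc j % t) ≡ κ (0 , x) ⁻¹) (sym (m<n⇒m%n≡m j<t))
                         (flips (fibre (s≤s z≤n) j<t))

    along-base : ∀ i → i ≤ s → κ (i , 0) ≡ κ₀ ℙ.+ parity i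
    along-base = parity-walk κ (λ i → i , 0) (λ i i<s → flips (base (s≤s i<s) 0<t))

    t-even : parity t ≡ 0ℙ
    t-even = sym (ℙP.+-cancelˡ-≡ κ₀ 0ℙ (parity t) (begin
      κ₀ ℙ.+ 0ℙ         ≡⟨ ℙP.+-identityʳ κ₀ ⟩
      κ₀                ≡⟨ cong (λ x → κ (0 , x)) (n%n≡0 t) ⟨
      κ (0 , t % t)     ≡⟨ around-fibre t ℕP.≤-refl ⟩
      κ₀ ℙ.+ parity t   ∎))

    twist-parity : parity (φ 0) ≡ parity (suc s)
    twist-parity = ℙP.+-cancelˡ-≡ κ₀ (parity (φ 0)) (parity (suc s)) (begin
      κ₀ ℙ.+ parity (φ 0)        ≡⟨ around-fibre (φ 0) (ℕP.<⇒≤ φ0<t) ⟨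
      κ (0 , φ 0 % t)            ≡⟨ cong (λ x → κ (0 , x)) (m<n⇒m%n≡m φ0<t) ⟩
      κ (0 , φ 0)                ≡⟨ flips (twist 0<t) ⟩
      κ (s , 0) ⁻¹               ≡⟨ cong _⁻¹ (along-base s ℕP.≤-refl) ⟩
      (κ₀ ℙ.+ parity s) ⁻¹       ≡⟨ ⁻¹-distribʳ-+ κ₀ (parity s) ⟩
      κ₀ ℙ.+ parity s ⁻¹         ≡⟨ cong (κ₀ ℙ.+_) (parity-suc s) ⟨
      κ₀ ℙ.+ parity (suc s)      ∎)

  bipartite⇔ : ∀ {a} → φ 0 ≡ a → a < t →
               (parity t ≡ 0ℙ → ∀ j → j < t → parity (φ j) ≡ parity a ℙ.+ parity j) →
               Bipartite (suc s) t φ ⇔ (parity t ≡ 0ℙ × parity (suc s) ≡ parity a)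
  bipartite⇔ {a} refl a<t parity-affine = mk⇔
    (λ bip → let t-even , twist-parity = bipartite⇒parity a<t bip in t-even , sym twist-parity)
    (λ (t-even , s-parity) → parity-colouring t-even λ j j<t → begin
      parity (φ j)                  ≡⟨ parity-affine t-even j j<t ⟩
      parity a ℙ.+ parity j         ≡⟨ cong (ℙ._+ parity j) s-parity ⟨
      parity (suc s) ℙ.+ parity j   ≡⟨ ℙP.+-homo-+ (suc s) j ⟨
      parity (suc s + j)            ∎)

shift-parity : ∀ t .{{_ : NonZero t}} d → parity t ≡ 0ℙ →
               ∀ j → parity (shift t d j) ≡ parity d ℙ.+ parity j
shift-parity t d t-even j = begin
  parity ((j + d) % t)       ≡⟨ parity-%-even (j + d) t t-even ⟩
  parity (j + d)             ≡⟨ ℙP.+-homo-+ j d ⟩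
  parity j ℙ.+ parity d      ≡⟨ ℙP.+-comm (parity j) (parity d) ⟩
  parity d ℙ.+ parity j      ∎

-- Reflections

+a≡+r+k*t⇒a≡r⊎a≡r+t : ∀ {a r t} → a < t + t → r < t → (k : ℤ) →
                      ℤ.+ a ≡ ℤ.+ r ℤ.+ k ℤ.* ℤ.+ t → a ≡ r ⊎ a ≡ r + t
+a≡+r+k*t⇒a≡r⊎a≡r+t {a} {r} {t} a<2t r<t (ℤ.+ n) eq = from-ℕ n (ℤP.+-injective (begin
  ℤ.+ a                         ≡⟨ eq ⟩
  ℤ.+ r ℤ.+ ℤ.+ n ℤ.* ℤ.+ t     ≡⟨ cong (ℤ._+_ (ℤ.+ r)) (ℤP.pos-* n t) ⟨
  ℤ.+ r ℤ.+ ℤ.+ (n * t)         ≡⟨ ℤP.pos-+ r (n * t) ⟨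
  ℤ.+ (r + n * t)               ∎))
  where
  from-ℕ : ∀ n → a ≡ r + n * t → a ≡ r ⊎ a ≡ r + t
  from-ℕ zero          a≡ = inj₁ (trans a≡ (ℕP.+-identityʳ r))
  from-ℕ (suc zero)    a≡ = inj₂ (trans a≡ (cong (r +_) (ℕP.+-identityʳ t)))
  from-ℕ (suc (suc n)) a≡ = contradiction a<2t (ℕP.≤⇒≯ (subst (t + t ≤_) (sym a≡)
    (ℕP.≤-trans (ℕP.+-monoʳ-≤ t (ℕP.m≤m+n t (n * t))) (ℕP.m≤n+m _ r))))
+a≡+r+k*t⇒a≡r⊎a≡r+t {a} {r} {t} a<2t r<t -[1+ n ] eq =
  contradiction r<t (ℕP.≤⇒≯ (subst (t ≤_) a+[1+n]t≡r (ℕP.≤-trans (ℕP.m≤m+n t (n * t)) (ℕP.m≤n+m _ a))))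
  where
  cancel : ∀ r m t → (r ℤ.+ ℤ.- m ℤ.* t) ℤ.+ m ℤ.* t ≡ r
  cancel = solve-∀

  a+[1+n]t≡r : a + suc n * t ≡ r
  a+[1+n]t≡r = ℤP.+-injective (begin
    ℤ.+ (a + suc n * t)                                       ≡⟨ ℤP.pos-+ a (suc n * t) ⟩
    ℤ.+ a ℤ.+ ℤ.+ (suc n * t)                                 ≡⟨ cong₂ ℤ._+_ eq (ℤP.pos-* (suc n) t) ⟩
    ℤ.+ r ℤ.+ -[1+ n ] ℤ.* ℤ.+ t ℤ.+ ℤ.+ suc n ℤ.* ℤ.+ t      ≡⟨ cancel (ℤ.+ r) (ℤ.+ suc n) (ℤ.+ t) ⟩
    ℤ.+ r                                                     ∎)

+-shift⇒≤ : ∀ {x y j u} → x + j ≡ y + j + u → u ≤ x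
+-shift⇒≤ {x} {y} {j} {u} eq = subst (u ≤_) (sym x≡y+u) (ℕP.m≤n+m u y)
  where
  x≡y+u : x ≡ y + u
  x≡y+u = ℕP.+-cancelʳ-≡ j x (y + u) (trans eq
    (trans (ℕP.+-assoc y j u) (trans (cong (y +_) (ℕP.+-comm j u)) (sym (ℕP.+-assoc y u j)))))

-- A fixed point j < t of j ↦ c - j (mod t) satisfies 2j = r or 2j = r + t, where r = c mod t,
-- so the fixed points are counted by the even numbers among r and r + t.
reflectionFixCount : Parity → Parity → ℕ
reflectionFixCount pt pr = toℕ (pr ⁻¹) + toℕ ((pr ℙ.+ pt) ⁻¹)

module _ (t : ℕ) .{{_ : NonZero t}} (c : ℤ) where

  private
    r = c %ℕ t
    ρ = reflection t c

  reflection-zero : ρ 0 ≡ r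
  reflection-zero = cong (_%ℕ t) (ℤP.+-identityʳ c)

  reflection-+ : ∀ {j} → j < t → ρ j + j ≡ r ⊎ ρ j + j ≡ r + t
  reflection-+ {j} j<t =
    +a≡+r+k*t⇒a≡r⊎a≡r+t (ℕP.+-mono-< (n%ℕd<d x t) j<t) (n%ℕd<d c t) (q ℤ.- q′) congruence
    where
    x = c ℤ.- ℤ.+ j
    q = c /ℕ t
    q′ = x /ℕ t

    move : ∀ a b q t → a ℤ.+ b ≡ (a ℤ.+ q ℤ.* t) ℤ.+ b ℤ.- q ℤ.* t
    move = solve-∀
    cancel : ∀ c b y → (c ℤ.- b) ℤ.+ b ℤ.- y ≡ c ℤ.- y
    cancel = solve-∀
    collect : ∀ r q q′ t → (r ℤ.+ q ℤ.* t) ℤ.- q′ ℤ.* t ≡ r ℤ.+ (q ℤ.- q′) ℤ.* t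
    collect = solve-∀

    congruence : ℤ.+ (ρ j + j) ≡ ℤ.+ r ℤ.+ (q ℤ.- q′) ℤ.* ℤ.+ t
    congruence = begin
      ℤ.+ (ρ j + j)                                         ≡⟨ ℤP.pos-+ (ρ j) j ⟩
      ℤ.+ ρ j ℤ.+ ℤ.+ j                                     ≡⟨ move (ℤ.+ ρ j) (ℤ.+ j) q′ (ℤ.+ t) ⟩
      (ℤ.+ ρ j ℤ.+ q′ ℤ.* ℤ.+ t) ℤ.+ ℤ.+ j ℤ.- q′ ℤ.* ℤ.+ t  ≡⟨ cong (λ y → y ℤ.+ ℤ.+ j ℤ.- q′ ℤ.* ℤ.+ t) (a≡a%ℕn+[a/ℕn]*n x t) ⟨
      x ℤ.+ ℤ.+ j ℤ.- q′ ℤ.* ℤ.+ t                          ≡⟨ cancel c (ℤ.+ j) (q′ ℤ.* ℤ.+ t) ⟩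
      c ℤ.- q′ ℤ.* ℤ.+ t                                    ≡⟨ cong (ℤ._- q′ ℤ.* ℤ.+ t) (a≡a%ℕn+[a/ℕn]*n c t) ⟩
      (ℤ.+ r ℤ.+ q ℤ.* ℤ.+ t) ℤ.- q′ ℤ.* ℤ.+ t              ≡⟨ collect (ℤ.+ r) q q′ (ℤ.+ t) ⟩
      ℤ.+ r ℤ.+ (q ℤ.- q′) ℤ.* ℤ.+ t                        ∎

  reflection-parity : parity t ≡ 0ℙ → ∀ j → j < t → parity (ρ j) ≡ parity r ℙ.+ parity j
  reflection-parity t-even j j<t =
    +≡⇒≡+ (trans (sym (ℙP.+-homo-+ (ρ j) j)) (Sum.[ cong parity , r+t-case ]′ (reflection-+ j<t)))
    where
    r+t-case : ρ j + j ≡ r + t → parity (ρ j + j) ≡ parity r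
    r+t-case eq = begin
      parity (ρ j + j)        ≡⟨ cong parity eq ⟩
      parity (r + t)          ≡⟨ ℙP.+-homo-+ r t ⟩
      parity r ℙ.+ parity t   ≡⟨ cong (parity r ℙ.+_) t-even ⟩
      parity r ℙ.+ 0ℙ         ≡⟨ ℙP.+-identityʳ (parity r) ⟩
      parity r                ∎

  reflection-fixed⇔ : ∀ {j} → j < t → (ρ j ≡ j) ⇔ (j + j ≡ r ⊎ j + j ≡ r + t)
  reflection-fixed⇔ {j} j<t = mk⇔
    (λ ρj≡j → subst (λ y → y + j ≡ r ⊎ y + j ≡ r + t) ρj≡j (reflection-+ j<t))
    (fixed (reflection-+ j<t))
    where
    fixed : (ρ j + j ≡ r ⊎ ρ j + j ≡ r + t) → (j + j ≡ r ⊎ j + j ≡ r + t) → ρ j ≡ j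
    fixed (inj₁ eq) (inj₁ eq′) = ℕP.+-cancelʳ-≡ j (ρ j) j (trans eq (sym eq′))
    fixed (inj₂ eq) (inj₂ eq′) = ℕP.+-cancelʳ-≡ j (ρ j) j (trans eq (sym eq′))
    fixed (inj₁ eq) (inj₂ eq′) =
      contradiction (+-shift⇒≤ (trans eq′ (cong (_+ t) (sym eq)))) (ℕP.<⇒≱ j<t)
    fixed (inj₂ eq) (inj₁ eq′) =
      contradiction (+-shift⇒≤ (trans eq (cong (_+ t) (sym eq′)))) (ℕP.<⇒≱ (n%ℕd<d (c ℤ.- ℤ.+ j) t))

  fixCount-reflection : fixCount t ρ ≡ reflectionFixCount (parity t) (parity r)
  fixCount-reflection = begin
    count (λ j → ρ j ℕP.≟ j) t
      ≡⟨ count-⊎ _ _ _ t (λ j → reflection-fixed⇔) distinct ⟩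
    count (λ j → j + j ℕP.≟ r) t + count (λ j → j + j ℕP.≟ r + t) t
      ≡⟨ cong₂ _+_ (count-double {n = t} (ℕP.<-≤-trans r<t (ℕP.m≤m+n t t))) (count-double {n = t} (ℕP.+-monoˡ-< t r<t)) ⟩
    toℕ (parity r ⁻¹) + toℕ (parity (r + t) ⁻¹)
      ≡⟨ cong (λ p → toℕ (parity r ⁻¹) + toℕ (p ⁻¹)) (ℙP.+-homo-+ r t) ⟩
    reflectionFixCount (parity t) (parity r)
      ∎
    where
    r<t : r < t
    r<t = n%ℕd<d c t
    distinct : ∀ j → ¬ (j + j ≡ r × j + j ≡ r + t)
    distinct j (eq , eq′) = ℕP.<⇒≢ (ℕP.m<m+n r (>-nonZero⁻¹ t)) (trans (sym eq) eq′)

even-reflection⇔ : ∀ pt pr ps →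
  (pt ≡ 0ℙ × ps ≡ pr) ⇔
  ((reflectionFixCount pt pr ≡ 0 × toℕ ps ≡ 1) ⊎ (reflectionFixCount pt pr ≡ 2 × toℕ ps ≡ 0))
even-reflection⇔ pt pr ps = mk⇔ to from
  where
  to : ∀ {pt pr ps} → pt ≡ 0ℙ × ps ≡ pr →
       (reflectionFixCount pt pr ≡ 0 × toℕ ps ≡ 1) ⊎ (reflectionFixCount pt pr ≡ 2 × toℕ ps ≡ 0)
  to {pr = 0ℙ} (refl , refl) = inj₂ (refl , refl)
  to {pr = 1ℙ} (refl , refl) = inj₁ (refl , refl)

  from : ∀ {pt pr ps} →
         (reflectionFixCount pt pr ≡ 0 × toℕ ps ≡ 1) ⊎ (reflectionFixCount pt pr ≡ 2 × toℕ ps ≡ 0) →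
         pt ≡ 0ℙ × ps ≡ pr
  from {0ℙ} {0ℙ} {0ℙ} (inj₂ _)       = refl , refl
  from {0ℙ} {1ℙ} {1ℙ} (inj₁ _)       = refl , refl
  from {0ℙ} {0ℙ} {_}  (inj₁ (() , _))
  from {0ℙ} {0ℙ} {1ℙ} (inj₂ (_ , ()))
  from {0ℙ} {1ℙ} {0ℙ} (inj₁ (_ , ()))
  from {0ℙ} {1ℙ} {_}  (inj₂ (() , _))
  from {1ℙ} {0ℙ} {_}  (inj₁ (() , _))
  from {1ℙ} {0ℙ} {_}  (inj₂ (() , _))
  from {1ℙ} {1ℙ} {_}  (inj₁ (() , _))
  from {1ℙ} {1ℙ} {_}  (inj₂ (() , _))

lemma2p3 : (s t : ℕ) .{{_ : NonZero t}} → 3 ≤ s → 3 ≤ t →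
    ((d : ℕ) → 1 ≤ d → d < t →
      (Bipartite s t (shift t d) ⇔ (t % 2 ≡ 0 × s % 2 ≡ d % 2)))
    × ((c : ℤ) →
      (Bipartite s t (reflection t c) ⇔
        ((fixCount t (reflection t c) ≡ 0 × s % 2 ≡ 1)
          ⊎ (fixCount t (reflection t c) ≡ 2 × s % 2 ≡ 0))))
lemma2p3 (suc s) t (s≤s _) _ = shift-case , reflection-case
  where
  shift-case : (d : ℕ) → 1 ≤ d → d < t → Bipartite (suc s) t (shift t d) ⇔ (t % 2 ≡ 0 × suc s % 2 ≡ d % 2)
  shift-case d _ d<t = ⇔.trans
    (bipartite⇔ s t (shift t d) (m<n⇒m%n≡m d<t) d<t (λ t-even j _ → shift-parity t d t-even j))
    (parity≡⇔%2≡ t 0 ×-⇔ parity≡⇔%2≡ (suc s) d)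

  reflection-case : (c : ℤ) → Bipartite (suc s) t (reflection t c) ⇔
    ((fixCount t (reflection t c) ≡ 0 × suc s % 2 ≡ 1) ⊎ (fixCount t (reflection t c) ≡ 2 × suc s % 2 ≡ 0))
  reflection-case c = ⇔.trans
    (bipartite⇔ s t (reflection t c) (reflection-zero t c) (n%ℕd<d c t) (reflection-parity t c))
    (subst₂ (λ F S → (parity t ≡ 0ℙ × parity (suc s) ≡ parity (c %ℕ t)) ⇔ ((F ≡ 0 × S ≡ 1) ⊎ (F ≡ 2 × S ≡ 0)))
      (sym (fixCount-reflection t c)) (sym (%2≡toℕ∘parity (suc s)))
      (even-reflection⇔ (parity t) (parity (c %ℕ t)) (parity (suc s))))
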